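{- For each $m\in\{2,3,4,5\}$, there exists an optimal $2$-D $(m\times 4,3,1)$-OOC with $J^*(m\times 4,3,1)$ codewords.
   Context: Let $I_m=\{0,1,\dots,m-1\}$ and $\mathbb{Z}_n$ the integers modulo $n$. A $2$-D $(m\times n,k,1)$-OOC is a set $\mathcal{C}$ of $k$-subsets of $I_m\times\mathbb{Z}_n$ such that $|A\cap(A+\tau)|\le 1$ for every $A\in\mathcal{C}$ and every integer $\tau\not\equiv 0\pmod n$, and $|A\cap(B+\tau)|\le 1$ for all distinct $A,B\in\mathcal{C}$ and every integer $\tau$, where $B+\tau=\{(i,x+\tau \bmod n):(i,x)\in B\}$. It is optimal if it has the maximum possible number of codewords. $J(m\times n,3,1)=\left\lfloor \frac{m}{3}\left\lfloor\frac{mn-1}{2}\right\rfloor\right\rfloor$. For even $n$, $J^*(m\times n,3,1)=J(m\times n,3,1)-1$ if $mn\equiv 14,20\pmod{24}$, or $m\equiv 4\pmod 6$ and $n=4$, or $m\equiv 5,8\pmod{12}$ and $n=2$, or $m\equiv 0\pmod 3$ and $mn\equiv 6,12\pmod{24}$; and $J^*(m\times n,3,1)=J(m\times n,3,1)$ otherwise. -}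

module Defs where

open import Data.Nat using (ℕ; zero; suc; _+_; _*_; _∸_; _≤_; NonZero)
open import Data.Nat.DivMod using (_/_; _%_; _mod_)
open import Data.Fin using (Fin; toℕ) renaming (zero to fzero)
open import Data.Fin using () renaming (_≟_ to _≟ᶠ_)
open import Data.Product using (_×_; _,_)
open import Data.Product.Properties using (≡-dec)
open import Data.List using (List; length; map; filter; lookup)
open import Data.List.Relation.Unary.Unique.Propositional using (Unique)
open import Data.List.Membership.DecPropositional using (_∈?_)
open import Data.Bool using (Bool; true; false; if_then_else_; _∨_; _∧_)
open import Data.Nat using (_≡ᵇ_)
open import Relation.Binary.PropositionalEquality using (_≡_; _≢_)
open import Relation.Binary.Definitions using (DecidableEquality)

Point : ℕ → ℕ → Set
Point m n = Fin m × Fin n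

_≟ₚ_ : ∀ {m n} → DecidableEquality (Point m n)
_≟ₚ_ = ≡-dec _≟ᶠ_ _≟ᶠ_

shiftPt : ∀ {m n} .{{_ : NonZero n}} → Fin n → Point m n → Point m n
shiftPt {n = n} τ (i , x) = i , ((toℕ x + toℕ τ) mod n)

shift : ∀ {m n} .{{_ : NonZero n}} → Fin n → List (Point m n) → List (Point m n)
shift τ B = map (shiftPt τ) B

-- |A ∩ B|, for A, B given as duplicate-free lists
∣_∩_∣ : ∀ {m n} → List (Point m n) → List (Point m n) → ℕ
∣ A ∩ B ∣ = length (filter (λ p → _∈?_ _≟ₚ_ p B) A)

IsKSubset : ∀ {m n} → ℕ → List (Point m n) → Set
IsKSubset k A = length A ≡ k × Unique A

record IsOOC (m n k : ℕ) .{{_ : NonZero n}} (C : List (List (Point m n))) : Set where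
  field
    subsets   : ∀ (a : Fin (length C)) → IsKSubset k (lookup C a)
    autocorr  : ∀ (a : Fin (length C)) (τ : Fin n) → toℕ τ ≢ 0 →
                ∣ lookup C a ∩ shift τ (lookup C a) ∣ ≤ 1
    crosscorr : ∀ (a b : Fin (length C)) → a ≢ b → (τ : Fin n) →
                ∣ lookup C a ∩ shift τ (lookup C b) ∣ ≤ 1

IsOptimalOOC : (m n k : ℕ) .{{_ : NonZero n}} → List (List (Point m n)) → Set
IsOptimalOOC m n k C =
  IsOOC m n k C × (∀ (D : List (List (Point m n))) → IsOOC m n k D → length D ≤ length C)

J : ℕ → ℕ → ℕ
J m n = (m * ((m * n ∸ 1) / 2)) / 3

exceptional : ℕ → ℕ → Bool
exceptional m n =
  let r = (m * n) % 24 in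
  ((r ≡ᵇ 14) ∨ (r ≡ᵇ 20))
  ∨ (((m % 6) ≡ᵇ 4) ∧ (n ≡ᵇ 4))
  ∨ ((((m % 12) ≡ᵇ 5) ∨ ((m % 12) ≡ᵇ 8)) ∧ (n ≡ᵇ 2))
  ∨ (((m % 3) ≡ᵇ 0) ∧ ((r ≡ᵇ 6) ∨ (r ≡ᵇ 12)))

-- J*(m × n, 3, 1) for even n
J* : ℕ → ℕ → ℕ
J* m n = if exceptional m n then J m n ∸ 1 else J m n

{-# OPTIONS --safe #-}
module Submission where

-- Every codeword of a 2-D (m × n, 3, 1)-OOC yields six differences (i, j, y − x) ∈ I_m × I_m × ℤ_n,
-- one per ordered pair (i, x), (j, y) of its points, and the correlation conditions force all these
-- differences to be distinct, within a codeword and across codewords. Summing a weight over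
-- the differences used therefore bounds the code size. For n = 4 the load weight gives every codeword
-- load 6 against a total of 4m² − 2m, so |C| ≤ 2, 5, 9, 15 for m = 2, 3, 4, 5. For m = 3, 5 the bound
-- would force every difference of positive load to be used, contradicting the parity of the charge
-- weight; for m = 4 a count modulo 4 over the three perfect matchings of K₄ is needed as well. The
-- weights of single codewords are computed by enumerating all 3-subsets of I_m × ℤ₄.

open import Defs
open import Algebra.Properties.CommutativeSemigroup using (interchange)
open import Data.Bool using (Bool; true; false; T; if_then_else_; _∧_; _xor_)
import Data.Bool.Properties as Bool
open import Data.Empty using (⊥; ⊥-elim)
open import Data.Fin using (Fin; toℕ)
open import Data.Fin.Patterns using (0F; 1F; 2F; 3F; 4F)
import Data.Fin.Properties as Fin
open import Data.Fin.Properties using (toℕ-injective; toℕ-fromℕ<; toℕ<n) renaming (_≟_ to _≟ᶠ_)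
open import Data.List
  using ( List; []; _∷_; _++_; [_]; map; filter; length; lookup; concatMap
        ; cartesianProduct; cartesianProductWith; allFin)
open import Data.List.Properties using (map-++; map-cong; tabulate-lookup)
open import Data.List.Membership.DecPropositional using (_∈?_)
open import Data.List.Membership.Propositional using (_∈_)
open import Data.List.Membership.Propositional.Properties
  using ( ∈-∃++; ∈-++⁻; ∈-++⁺ˡ; ∈-++⁺ʳ; ∈-map⁺; ∈-map⁻; ∈-filter⁺; ∈-filter⁻; ∈-allFin
        ; ∈-cartesianProduct⁻; ∈-cartesianProduct⁺; ∈-cartesianProductWith⁺)
open import Data.List.Relation.Binary.Disjoint.Propositional using (Disjoint)
import Data.List.Relation.Binary.Permutation.Propositional.Properties as ↭
open import Data.List.Relation.Unary.All as All using (All; []; _∷_)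
import Data.List.Relation.Unary.All.Properties as All
open import Data.List.Relation.Unary.AllPairs as AllPairs using (AllPairs; []; _∷_)
import Data.List.Relation.Unary.AllPairs.Properties as AllPairs
open import Data.List.Relation.Unary.Any using (here; there)
open import Data.List.Relation.Unary.Unique.DecPropositional using (unique?)
open import Data.List.Relation.Unary.Unique.Propositional using (Unique)
import Data.List.Relation.Unary.Unique.Propositional.Properties as Unique
open import Data.Nat using (ℕ; zero; suc; pred; _+_; _*_; _∸_; _≤_; z≤n; s≤s; _<ᵇ_; _≟_; _≤?_; NonZero)
open import Data.Nat.DivMod
  using (_%_; _mod_; %-distribˡ-+; m%n%n≡m%n; [m+n]%n≡m%n; [m+kn]%n≡m%n; m<n⇒m%n≡m; n%n≡0)
open import Data.Nat.ListAction using (sum)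
open import Data.Nat.ListAction.Properties using (sum-++; sum-↭)
open import Data.Nat.Properties
open import Data.Product using (Σ; ∃; _×_; _,_; proj₁; proj₂; uncurry)
open import Data.Product.Properties using (≡-dec)
open import Data.Sum using (_⊎_; inj₁; inj₂)
open import Function using (_∘_)
open import Relation.Binary.Definitions using (DecidableEquality)
open import Relation.Binary.PropositionalEquality
  using (_≡_; _≢_; refl; sym; trans; cong; cong₂; subst; subst₂; ≢-sym; module ≡-Reasoning)
open import Relation.Nullary using (Dec; yes; no; does; contradiction)
open import Relation.Nullary.Decidable using (True; toWitness; from-yes; ¬?; _×-dec_; _→-dec_; map′)
open import Relation.Unary using (Decidable)

[m+n%d]%d≡[m+n]%d : ∀ m n d .{{_ : NonZero d}} → (m + n % d) % d ≡ (m + n) % d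
[m+n%d]%d≡[m+n]%d m n d = begin
  (m + n % d) % d         ≡⟨ %-distribˡ-+ m (n % d) d ⟩
  (m % d + n % d % d) % d ≡⟨ cong (λ k → (m % d + k) % d) (m%n%n≡m%n n d) ⟩
  (m % d + n % d) % d     ≡⟨ %-distribˡ-+ m n d ⟨
  (m + n) % d             ∎
  where open ≡-Reasoning

[m%d+n]%d≡[m+n]%d : ∀ m n d .{{_ : NonZero d}} → (m % d + n) % d ≡ (m + n) % d
[m%d+n]%d≡[m+n]%d m n d = begin
  (m % d + n) % d ≡⟨ cong (_% d) (+-comm (m % d) n) ⟩
  (n + m % d) % d ≡⟨ [m+n%d]%d≡[m+n]%d n m d ⟩
  (n + m) % d     ≡⟨ cong (_% d) (+-comm n m) ⟩
  (m + n) % d     ∎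
  where open ≡-Reasoning

module _ {A : Set} where

  weight : (A → ℕ) → List A → ℕ
  weight f xs = sum (map f xs)

  weight-++ : ∀ f xs ys → weight f (xs ++ ys) ≡ weight f xs + weight f ys
  weight-++ f xs ys = trans (cong sum (map-++ f xs ys)) (sum-++ (map f xs) (map f ys))

  ∈-++-∷⁻ : ∀ {x y : A} xs {ys} → y ∈ xs ++ x ∷ ys → y ≢ x → y ∈ xs ++ ys
  ∈-++-∷⁻ xs y∈ y≢x with ∈-++⁻ xs y∈
  ... | inj₁ y∈xs         = ∈-++⁺ˡ y∈xs
  ... | inj₂ (here y≡x)   = ⊥-elim (y≢x y≡x)
  ... | inj₂ (there y∈ys) = ∈-++⁺ʳ xs y∈ys

  weight-mono-⊆ : ∀ f {xs ys} → Unique xs → (∀ {x} → x ∈ xs → x ∈ ys) → weight f xs ≤ weight f ys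
  weight-mono-⊆ f {[]}     _             _      = z≤n
  weight-mono-⊆ f {x ∷ xs} (x∉xs ∷ !xs) xs⊆ys with ws , zs , refl ← ∈-∃++ (xs⊆ys (here refl)) = begin
    f x + weight f xs         ≤⟨ +-monoʳ-≤ (f x) (weight-mono-⊆ f !xs xs⊆ws++zs) ⟩
    f x + weight f (ws ++ zs) ≡⟨ sum-↭ (↭.map⁺ f (↭.shift x ws zs)) ⟨
    weight f (ws ++ x ∷ zs)   ∎
    where
    open ≤-Reasoning
    xs⊆ws++zs : ∀ {y} → y ∈ xs → y ∈ ws ++ zs
    xs⊆ws++zs y∈xs = ∈-++-∷⁻ ws (xs⊆ys (there y∈xs)) (≢-sym (All.lookup x∉xs y∈xs))

  weight-cong : ∀ {f g} → (∀ x → f x ≡ g x) → ∀ xs → weight f xs ≡ weight g xs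
  weight-cong f≗g xs = cong sum (map-cong f≗g xs)

  weight-+ : ∀ f g xs → weight (λ x → f x + g x) xs ≡ weight f xs + weight g xs
  weight-+ f g []       = refl
  weight-+ f g (x ∷ xs) =
    trans (cong (f x + g x +_) (weight-+ f g xs)) (interchange +-commutativeSemigroup (f x) (g x) _ _)

  weight-*ˡ : ∀ k f xs → weight (λ x → k * f x) xs ≡ k * weight f xs
  weight-*ˡ k f []       = sym (*-zeroʳ k)
  weight-*ˡ k f (x ∷ xs) = trans (cong (k * f x +_) (weight-*ˡ k f xs)) (sym (*-distribˡ-+ k (f x) _))

  weight-const : ∀ {f c xs} → All (λ x → f x ≡ c) xs → weight f xs ≡ length xs * c
  weight-const []         = refl
  weight-const (fx≡c ∷ p) = cong₂ _+_ fx≡c (weight-const p)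

  weight-% : ∀ {f d r xs} .{{_ : NonZero d}} → All (λ x → f x % d ≡ r) xs →
             weight f xs % d ≡ (length xs * r) % d
  weight-% []                                 = refl
  weight-% {f} {d} {r} {x ∷ xs} (fx%d≡r ∷ p) = begin
    (f x + weight f xs) % d        ≡⟨ [m+n%d]%d≡[m+n]%d (f x) (weight f xs) d ⟨
    (f x + weight f xs % d) % d    ≡⟨ cong (λ k → (f x + k) % d) (weight-% p) ⟩
    (f x + length xs * r % d) % d  ≡⟨ [m+n%d]%d≡[m+n]%d (f x) (length xs * r) d ⟩
    (f x + length xs * r) % d      ≡⟨ [m%d+n]%d≡[m+n]%d (f x) (length xs * r) d ⟨
    (f x % d + length xs * r) % d  ≡⟨ cong (λ k → (k + length xs * r) % d) fx%d≡r ⟩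
    (r + length xs * r) % d        ∎
    where open ≡-Reasoning

  length-mono-⊆ : ∀ {xs ys} → Unique xs → (∀ {x} → x ∈ xs → x ∈ ys) → length xs ≤ length ys
  length-mono-⊆ {xs} {ys} !xs xs⊆ys =
    subst₂ _≤_ (weight-1 xs) (weight-1 ys) (weight-mono-⊆ (λ _ → 1) !xs xs⊆ys)
    where
    weight-1 : ∀ zs → weight (λ _ → 1) zs ≡ length zs
    weight-1 []       = refl
    weight-1 (_ ∷ zs) = cong suc (weight-1 zs)

  weight-+-*ˡ : ∀ f k g xs → weight (λ x → f x + k * g x) xs ≡ weight f xs + k * weight g xs
  weight-+-*ˡ f k g xs = trans (weight-+ f (λ x → k * g x) xs) (cong (weight f xs +_) (weight-*ˡ k g xs))

  -- g and k · f ∸ g are both monotone under inclusion, and they add up to k · f, whose totals agree.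
  weight-tight : ∀ f g k {xs ys} → Unique xs → (∀ {x} → x ∈ xs → x ∈ ys) → (∀ x → g x ≤ k * f x) →
                 weight f xs ≡ weight f ys → weight g xs ≡ weight g ys
  weight-tight f g k {xs} {ys} !xs xs⊆ys g≤kf fxs≡fys =
    ≤-antisym (weight-mono-⊆ g !xs xs⊆ys) (+-cancelˡ-≤ (weight slack xs) _ _ gys≤gxs)
    where
    slack : A → ℕ
    slack x = k * f x ∸ g x
    slack+g : ∀ zs → weight slack zs + weight g zs ≡ k * weight f zs
    slack+g zs = begin
      weight slack zs + weight g zs       ≡⟨ weight-+ slack g zs ⟨
      weight (λ x → slack x + g x) zs     ≡⟨ weight-cong (λ x → m∸n+n≡m (g≤kf x)) zs ⟩
      weight (λ x → k * f x) zs           ≡⟨ weight-*ˡ k f zs ⟩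
      k * weight f zs                     ∎
      where open ≡-Reasoning
    gys≤gxs : weight slack xs + weight g ys ≤ weight slack xs + weight g xs
    gys≤gxs = begin
      weight slack xs + weight g ys ≤⟨ +-monoˡ-≤ _ (weight-mono-⊆ slack !xs xs⊆ys) ⟩
      weight slack ys + weight g ys ≡⟨ slack+g ys ⟩
      k * weight f ys               ≡⟨ cong (k *_) fxs≡fys ⟨
      k * weight f xs               ≡⟨ slack+g xs ⟨
      weight slack xs + weight g xs ∎
      where open ≤-Reasoning

weight-concatMap : ∀ {A B : Set} (f : B → ℕ) (g : A → List B) xs →
                   weight f (concatMap g xs) ≡ weight (weight f ∘ g) xs
weight-concatMap f g []       = refl
weight-concatMap f g (x ∷ xs) =
  trans (weight-++ f (g x) (concatMap g xs)) (cong (weight f (g x) +_) (weight-concatMap f g xs))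

Unique-map⁺ : ∀ {A B : Set} {f : A → B} {xs} → (∀ {x y} → x ∈ xs → y ∈ xs → f x ≡ f y → x ≡ y) →
              Unique xs → Unique (map f xs)
Unique-map⁺ {xs = []}    _   []             = []
Unique-map⁺ {xs = x ∷ _} inj (x∉xs ∷ !xs) =
  All.map⁺ (All.tabulate λ y∈xs fx≡fy → All.lookup x∉xs y∈xs (inj (here refl) (there y∈xs) fx≡fy))
  ∷ Unique-map⁺ (λ x∈ y∈ → inj (there x∈) (there y∈)) !xs

module _ {n : ℕ} .{{_ : NonZero n}} where

  infixl 6 _⊕_ _⊖_

  _⊕_ : Fin n → Fin n → Fin n
  x ⊕ τ = (toℕ x + toℕ τ) mod n

  _⊖_ : Fin n → Fin n → Fin n
  y ⊖ x = (toℕ y + (n ∸ toℕ x)) mod n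

  toℕ-mod : ∀ k → toℕ (k mod n) ≡ k % n
  toℕ-mod k = toℕ-fromℕ< _

  ⊕-identityʳ : ∀ x {τ} → toℕ τ ≡ 0 → x ⊕ τ ≡ x
  ⊕-identityʳ x τ≡0 = toℕ-injective (begin
    toℕ (x ⊕ _)      ≡⟨ toℕ-mod _ ⟩
    (toℕ x + _) % n  ≡⟨ cong (λ k → (toℕ x + k) % n) τ≡0 ⟩
    (toℕ x + 0) % n  ≡⟨ cong (_% n) (+-identityʳ (toℕ x)) ⟩
    toℕ x % n        ≡⟨ m<n⇒m%n≡m (toℕ<n x) ⟩
    toℕ x            ∎)
    where open ≡-Reasoning

  ⊖-self : ∀ x → toℕ (x ⊖ x) ≡ 0
  ⊖-self x = trans (toℕ-mod _) (trans (cong (_% n) (m+[n∸m]≡n (<⇒≤ (toℕ<n x)))) (n%n≡0 n))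

  ⊕-⊖ : ∀ x y x′ y′ → y ⊖ x ≡ y′ ⊖ x′ → y′ ⊕ (x ⊖ x′) ≡ y
  ⊕-⊖ x y x′ y′ eq = toℕ-injective (begin
    toℕ (y′ ⊕ (x ⊖ x′))                       ≡⟨ toℕ-mod _ ⟩
    (toℕ y′ + toℕ (x ⊖ x′)) % n               ≡⟨ cong (λ k → (toℕ y′ + k) % n) (toℕ-mod _) ⟩
    (toℕ y′ + (toℕ x + (n ∸ toℕ x′)) % n) % n ≡⟨ [m+n%d]%d≡[m+n]%d (toℕ y′) _ n ⟩
    (toℕ y′ + (toℕ x + (n ∸ toℕ x′))) % n     ≡⟨ cong (_% n) (rearrange (toℕ y′) (toℕ x) _) ⟩
    (toℕ y′ + (n ∸ toℕ x′) + toℕ x) % n       ≡⟨ [m%d+n]%d≡[m+n]%d _ (toℕ x) n ⟨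
    ((toℕ y′ + (n ∸ toℕ x′)) % n + toℕ x) % n ≡⟨ cong (λ k → (k + toℕ x) % n) (toℕ-mod _) ⟨
    (toℕ (y′ ⊖ x′) + toℕ x) % n               ≡⟨ cong (λ z → (toℕ z + toℕ x) % n) eq ⟨
    (toℕ (y ⊖ x) + toℕ x) % n                 ≡⟨ cong (λ k → (k + toℕ x) % n) (toℕ-mod _) ⟩
    ((toℕ y + (n ∸ toℕ x)) % n + toℕ x) % n   ≡⟨ [m%d+n]%d≡[m+n]%d _ (toℕ x) n ⟩
    (toℕ y + (n ∸ toℕ x) + toℕ x) % n         ≡⟨ cong (_% n) (+-assoc (toℕ y) _ _) ⟩
    (toℕ y + (n ∸ toℕ x + toℕ x)) % n         ≡⟨ cong (λ k → (toℕ y + k) % n) (m∸n+n≡m (<⇒≤ (toℕ<n x))) ⟩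
    (toℕ y + n) % n                           ≡⟨ [m+n]%n≡m%n (toℕ y) n ⟩
    toℕ y % n                                 ≡⟨ m<n⇒m%n≡m (toℕ<n y) ⟩
    toℕ y                                     ∎)
    where
    open ≡-Reasoning
    rearrange : ∀ a b c → a + (b + c) ≡ a + c + b
    rearrange a b c = trans (cong (a +_) (+-comm b c)) (sym (+-assoc a c b))

Diff : ℕ → ℕ → Set
Diff m n = Fin m × Fin m × Fin n

module _ {m n : ℕ} .{{_ : NonZero n}} where

  diff : Point m n → Point m n → Diff m n
  diff (i , x) (j , y) = i , j , y ⊖ x

  shiftPt-identity : ∀ {τ : Fin n} (p : Point m n) → toℕ τ ≡ 0 → shiftPt τ p ≡ p
  shiftPt-identity (i , x) τ≡0 = cong (i ,_) (⊕-identityʳ x τ≡0)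

  diff-≡⇒shifted : ∀ {u v u′ v′} → diff u v ≡ diff u′ v′ → ∃ λ τ → shiftPt τ u′ ≡ u × shiftPt τ v′ ≡ v
  diff-≡⇒shifted {i , x} {j , y} {i′ , x′} {j′ , y′} eq
    with refl ← cong proj₁ eq | refl ← cong (proj₁ ∘ proj₂) eq =
    x ⊖ x′ , cong (i ,_) (⊕-⊖ x x x′ x′ x⊖x≡x′⊖x′) , cong (j ,_) (⊕-⊖ x y x′ y′ (cong (proj₂ ∘ proj₂) eq))
    where
    x⊖x≡x′⊖x′ : x ⊖ x ≡ x′ ⊖ x′
    x⊖x≡x′⊖x′ = toℕ-injective (trans (⊖-self x) (sym (⊖-self x′)))

  distinctPairs : List (Point m n) → List (Point m n × Point m n)
  distinctPairs A = filter (λ (u , v) → ¬? (u ≟ₚ v)) (cartesianProduct A A)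

  diffs : List (Point m n) → List (Diff m n)
  diffs A = map (uncurry diff) (distinctPairs A)

  ∈-distinctPairs⁻ : ∀ A {u v} → (u , v) ∈ distinctPairs A → u ∈ A × v ∈ A × u ≢ v
  ∈-distinctPairs⁻ A p with ∈-filter⁻ (λ (u , v) → ¬? (u ≟ₚ v)) {xs = cartesianProduct A A} p
  ... | uv∈A² , u≢v = proj₁ (∈-cartesianProduct⁻ A A uv∈A²) , proj₂ (∈-cartesianProduct⁻ A A uv∈A²) , u≢v

  distinctPairs-unique : ∀ {A} → Unique A → Unique (distinctPairs A)
  distinctPairs-unique !A = Unique.filter⁺ _ (Unique.cartesianProduct⁺ !A !A)

  ∣∩∣-≥2 : ∀ {A B : List (Point m n)} {u v} → u ∈ A → v ∈ A → u ≢ v → u ∈ B → v ∈ B → 2 ≤ ∣ A ∩ B ∣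
  ∣∩∣-≥2 {A} {B} u∈A v∈A u≢v u∈B v∈B = length-mono-⊆ ((u≢v ∷ []) ∷ [] ∷ []) uv⊆A∩B
    where
    uv⊆A∩B : ∀ {x} → x ∈ _ ∷ _ ∷ [] → x ∈ filter (λ p → _∈?_ _≟ₚ_ p B) A
    uv⊆A∩B (here refl)         = ∈-filter⁺ (λ p → _∈?_ _≟ₚ_ p B) u∈A u∈B
    uv⊆A∩B (there (here refl)) = ∈-filter⁺ (λ p → _∈?_ _≟ₚ_ p B) v∈A v∈B

  AutoCorrelated : List (Point m n) → Set
  AutoCorrelated A = ∀ (τ : Fin n) → toℕ τ ≢ 0 → ∣ A ∩ shift τ A ∣ ≤ 1

  CrossCorrelated : List (Point m n) → List (Point m n) → Set
  CrossCorrelated A B = ∀ (τ : Fin n) → ∣ A ∩ shift τ B ∣ ≤ 1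

  Admissible : ℕ → List (Point m n) → Set
  Admissible k A = IsKSubset k A × Unique (diffs A)

  shifted-pair⇒overlap : ∀ {A B : List (Point m n)} {τ u v u′ v′} →
                         u ∈ A → v ∈ A → u ≢ v → u′ ∈ B → v′ ∈ B → shiftPt τ u′ ≡ u → shiftPt τ v′ ≡ v →
                         2 ≤ ∣ A ∩ shift τ B ∣
  shifted-pair⇒overlap {τ = τ} u∈A v∈A u≢v u′∈B v′∈B refl refl =
    ∣∩∣-≥2 u∈A v∈A u≢v (∈-map⁺ (shiftPt τ) u′∈B) (∈-map⁺ (shiftPt τ) v′∈B)

  diffs-unique : ∀ {A} → Unique A → AutoCorrelated A → Unique (diffs A)
  diffs-unique {A} !A auto = Unique-map⁺ injective (distinctPairs-unique !A)
    where
    injective : ∀ {p q} → p ∈ distinctPairs A → q ∈ distinctPairs A →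
                uncurry diff p ≡ uncurry diff q → p ≡ q
    injective {u , v} {u′ , v′} uv∈ uv′∈ eq
      with diff-≡⇒shifted eq | ∈-distinctPairs⁻ A uv∈ | ∈-distinctPairs⁻ A uv′∈
    ... | τ , τu′≡u , τv′≡v | u∈A , v∈A , u≢v | u′∈A , v′∈A , _ with toℕ τ ≟ 0
    ...   | yes τ≡0 = sym (cong₂ _,_ (trans (sym (shiftPt-identity u′ τ≡0)) τu′≡u)
                                     (trans (sym (shiftPt-identity v′ τ≡0)) τv′≡v))
    ...   | no  τ≢0 = ⊥-elim (≤⇒≯ (auto τ τ≢0) (shifted-pair⇒overlap u∈A v∈A u≢v u′∈A v′∈A τu′≡u τv′≡v))

  diffs-disjoint : ∀ {A B} → CrossCorrelated A B → Disjoint (diffs A) (diffs B)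
  diffs-disjoint {A} {B} cross (t∈A , t∈B) with ∈-map⁻ (uncurry diff) t∈A | ∈-map⁻ (uncurry diff) t∈B
  ... | _ , uv∈ , refl | _ , uv′∈ , eq
    with diff-≡⇒shifted eq | ∈-distinctPairs⁻ A uv∈ | ∈-distinctPairs⁻ B uv′∈
  ... | τ , τu′≡u , τv′≡v | u∈A , v∈A , u≢v | u′∈B , v′∈B , _ =
    ≤⇒≯ (cross τ) (shifted-pair⇒overlap u∈A v∈A u≢v u′∈B v′∈B τu′≡u τv′≡v)

diffsOf : ∀ {m n} .{{_ : NonZero n}} → List (List (Point m n)) → List (Diff m n)
diffsOf = concatMap diffs

module _ {m n : ℕ} where

  points : List (Point m n)
  points = cartesianProduct (allFin m) (allFin n)

  ∈-points : ∀ p → p ∈ points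
  ∈-points (i , x) = ∈-cartesianProduct⁺ (∈-allFin i) (∈-allFin x)

  allDiffs : List (Diff m n)
  allDiffs = cartesianProduct (allFin m) (cartesianProduct (allFin m) (allFin n))

  ∈-allDiffs : ∀ t → t ∈ allDiffs
  ∈-allDiffs (i , j , d) = ∈-cartesianProduct⁺ (∈-allFin i) (∈-cartesianProduct⁺ (∈-allFin j) (∈-allFin d))

  listsOfLength : ℕ → List (List (Point m n))
  listsOfLength zero    = [ [] ]
  listsOfLength (suc k) = cartesianProductWith _∷_ points (listsOfLength k)

  ∈-listsOfLength : ∀ A → A ∈ listsOfLength (length A)
  ∈-listsOfLength []      = here refl
  ∈-listsOfLength (p ∷ A) = ∈-cartesianProductWith⁺ _∷_ (∈-points p) (∈-listsOfLength A)

  module _ .{{_ : NonZero n}} where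

    _≟ᵈ_ : DecidableEquality (Diff m n)
    _≟ᵈ_ = ≡-dec _≟ᶠ_ (≡-dec _≟ᶠ_ _≟ᶠ_)

    admissible? : ∀ k → Decidable (Admissible k)
    admissible? k A = ((length A ≟ k) ×-dec unique? _≟ₚ_ A) ×-dec unique? _≟ᵈ_ (diffs A)

    admissible-by-enumeration : ∀ {P : List (Point m n) → Set} k (P? : Decidable P) →
      {True (All.all? (λ A → admissible? k A →-dec P? A) (listsOfLength k))} → ∀ {A} → Admissible k A → P A
    admissible-by-enumeration k P? {checked} {A} adm@((refl , _) , _) =
      All.lookup (toWitness checked) (∈-listsOfLength A) adm

    isOOC? : ∀ k (C : List (List (Point m n))) → Dec (IsOOC m n k C)
    isOOC? k C = map′ (λ (s , a , c) → record { subsets = s ; autocorr = a ; crosscorr = c })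
                      (λ o → IsOOC.subsets o , IsOOC.autocorr o , IsOOC.crosscorr o)
                      (Fin.all? subsets? ×-dec Fin.all? autocorr? ×-dec Fin.all? crosscorr?)
      where
      subsets? : ∀ a → Dec (IsKSubset k (lookup C a))
      subsets? a = (length (lookup C a) ≟ k) ×-dec unique? _≟ₚ_ (lookup C a)
      autocorr? : ∀ a → Dec (AutoCorrelated (lookup C a))
      autocorr? a = Fin.all? λ τ → ¬? (toℕ τ ≟ 0) →-dec (∣ lookup C a ∩ shift τ (lookup C a) ∣ ≤? 1)
      crosscorr? : ∀ a → Dec (∀ b → a ≢ b → CrossCorrelated (lookup C a) (lookup C b))
      crosscorr? a = Fin.all? λ b → ¬? (a ≟ᶠ b) →-dec Fin.all? λ τ → ∣ lookup C a ∩ shift τ (lookup C b) ∣ ≤? 1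

module _ {m n k : ℕ} .{{_ : NonZero n}} {C : List (List (Point m n))} (ooc : IsOOC m n k C) where
  open IsOOC ooc

  codewords-admissible : All (Admissible k) C
  codewords-admissible = subst (All _) (tabulate-lookup C)
    (All.tabulate⁺ (λ a → subsets a , diffs-unique (proj₂ (subsets a)) (autocorr a)))

  codewords-crossCorrelated : AllPairs CrossCorrelated C
  codewords-crossCorrelated = subst (AllPairs _) (tabulate-lookup C) (AllPairs.tabulate⁺ (crosscorr _ _))

  diffsOf-unique : Unique (diffsOf C)
  diffsOf-unique = Unique.concat⁺
    (All.map⁺ (All.map proj₂ codewords-admissible))
    (AllPairs.map⁺ (AllPairs.map {R = CrossCorrelated} (λ {A} {B} → diffs-disjoint {A = A} {B = B})
                                 codewords-crossCorrelated))

  diffsOf-⊆ : ∀ {t} → t ∈ diffsOf C → t ∈ allDiffs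
  diffsOf-⊆ {t} _ = ∈-allDiffs t

  diffsOf-weight≤ : ∀ f → weight f (diffsOf C) ≤ weight f allDiffs
  diffsOf-weight≤ f = weight-mono-⊆ f diffsOf-unique diffsOf-⊆

  diffsOf-weight : ∀ {f c} → (∀ {A} → Admissible k A → weight f (diffs A) ≡ c) →
                   weight f (diffsOf C) ≡ length C * c
  diffsOf-weight {f} hyp =
    trans (weight-concatMap f diffs C) (weight-const (All.map hyp codewords-admissible))

  diffsOf-weight-% : ∀ {f d r} .{{_ : NonZero d}} → (∀ {A} → Admissible k A → weight f (diffs A) % d ≡ r) →
                     weight f (diffsOf C) % d ≡ (length C * r) % d
  diffsOf-weight-% {f} {d} hyp =
    trans (cong (_% d) (weight-concatMap f diffs C)) (weight-% (All.map hyp codewords-admissible))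

module _ {m n : ℕ} where

  mixed : Diff m n → ℕ
  mixed (i , j , _) = if does (i ≟ᶠ j) then 0 else 1

  ascent : Diff m n → ℕ
  ascent (i , j , d) = if toℕ i <ᵇ toℕ j then toℕ d else 0

  ascent≤pred[n]*mixed : ∀ t → ascent t ≤ pred n * mixed t
  ascent≤pred[n]*mixed (i , j , d) with toℕ i <ᵇ toℕ j in i<ᵇj | i ≟ᶠ j
  ... | false | _        = z≤n
  ... | true  | yes refl = ⊥-elim (<-irrefl refl (<ᵇ⇒< (toℕ i) (toℕ i) (subst T (sym i<ᵇj) _)))
  ... | true  | no  _    = subst (toℕ d ≤_) (sym (*-identityʳ (pred n))) (Fin.toℕ≤pred[n] d)

module _ {m : ℕ} where

  -- A codeword with two points in row i contains both (i, i, 1) and (i, i, 3), but never (i, i, 0) or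
  -- (i, i, 2), which equals its own reverse; counting (i, i, 1) twice gives every codeword load 6.
  pure₁ : Diff m 4 → ℕ
  pure₁ (i , j , d) = if does (i ≟ᶠ j) ∧ does (d ≟ᶠ 1F) then 1 else 0

  load : Diff m 4 → ℕ
  load t = mixed t + 2 * pure₁ t

  -- The charge of a codeword is even, while the total charge 6 · C(m, 2) + m is odd for odd m.
  charge : Diff m 4 → ℕ
  charge t = ascent t + pure₁ t

  charge≤3*load : ∀ t → charge t ≤ 3 * load t
  charge≤3*load t = begin
    ascent t + pure₁ t               ≤⟨ +-mono-≤ (ascent≤pred[n]*mixed t) (m≤n*m (pure₁ t) 6) ⟩
    3 * mixed t + 6 * pure₁ t        ≡⟨ cong (3 * mixed t +_) (*-assoc 3 2 (pure₁ t)) ⟩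
    3 * mixed t + 3 * (2 * pure₁ t)  ≡⟨ *-distribˡ-+ 3 (mixed t) (2 * pure₁ t) ⟨
    3 * load t                       ∎
    where open ≤-Reasoning

  weight-charge : ∀ ts → weight charge ts ≡ weight ascent ts + weight pure₁ ts
  weight-charge = weight-+ ascent pure₁

  CodewordWeights : List (Point m 4) → Set
  CodewordWeights A = weight load (diffs A) ≡ 6 × weight charge (diffs A) % 2 ≡ 0

  codewordWeights? : Decidable CodewordWeights
  codewordWeights? A = (weight load (diffs A) ≟ 6) ×-dec (weight charge (diffs A) % 2 ≟ 0)

-- Rows of I₄ as vectors of 𝔽₂²: for each c ≠ 0 the row pairs {i, j} with i + j = c form one of the
-- three perfect matchings of K₄.
bits : Fin 4 → Bool × Bool
bits 0F = false , false
bits 1F = false , true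
bits 2F = true  , false
bits 3F = true  , true

rowClass : Fin 4 → Fin 4 → Bool × Bool
rowClass i j = proj₁ (bits i) xor proj₁ (bits j) , proj₂ (bits i) xor proj₂ (bits j)

matched : Bool × Bool → Diff 4 4 → ℕ
matched c (i , j , _) = if does (rowClass i j ≟ᶜ c) then 1 else 0
  where
  _≟ᶜ_ : DecidableEquality (Bool × Bool)
  _≟ᶜ_ = ≡-dec Bool._≟_ Bool._≟_

c₁ c₂ c₃ : Bool × Bool
c₁ = false , true
c₂ = true  , false
c₃ = true  , true

mixed≡Σmatched : ∀ t → mixed t ≡ matched c₁ t + matched c₂ t + matched c₃ t
-- Neither side depends on the ℤ₄-component, so checking it at 0 suffices.
mixed≡Σmatched (i , j , _) = from-yes (Fin.all? λ i → Fin.all? λ j → check (i , j , 0F)) i j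
  where
  check : ∀ t → Dec (mixed t ≡ matched c₁ t + matched c₂ t + matched c₃ t)
  check t = mixed t ≟ _

weight-mixed : ∀ ts → weight mixed ts ≡ weight (matched c₁) ts + weight (matched c₂) ts + weight (matched c₃) ts
weight-mixed ts = begin
  weight mixed ts                                                ≡⟨ weight-cong mixed≡Σmatched ts ⟩
  weight (λ t → matched c₁ t + matched c₂ t + matched c₃ t) ts   ≡⟨ weight-+ _ (matched c₃) ts ⟩
  weight (λ t → matched c₁ t + matched c₂ t) ts + weight (matched c₃) ts
    ≡⟨ cong (_+ weight (matched c₃) ts) (weight-+ (matched c₁) (matched c₂) ts) ⟩
  weight (matched c₁) ts + weight (matched c₂) ts + weight (matched c₃) ts ∎
  where open ≡-Reasoning

classLoad : Bool × Bool → Diff 4 4 → ℕ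
classLoad c t = matched c t + 2 * pure₁ t

classes : List (Bool × Bool)
classes = c₁ ∷ c₂ ∷ c₃ ∷ []

ClassWeights : List (Point 4 4) → Set
ClassWeights A = All (λ c → weight (classLoad c) (diffs A) % 4 ≡ 2) classes

classWeights? : Decidable ClassWeights
classWeights? A = All.all? (λ c → weight (classLoad c) (diffs A) % 4 ≟ 2) classes

module _ {m : ℕ} {C : List (List (Point m 4))} (ooc : IsOOC m 4 3 C)
         (weights : ∀ {A : List (Point m 4)} → Admissible 3 A → CodewordWeights A) where

  load-bound : length C * 6 ≤ weight load (allDiffs {m})
  load-bound = subst (_≤ _) (diffsOf-weight ooc (proj₁ ∘ weights)) (diffsOf-weight≤ ooc load)

  parity-bound : ∀ B → weight load (allDiffs {m}) ≡ suc B * 6 → weight charge (allDiffs {m}) % 2 ≡ 1 →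
                 length C ≤ B
  parity-bound B total-load odd-charge = ≤-pred (≤∧≢⇒< |C|≤1+B |C|≢1+B)
    where
    |C|≤1+B : length C ≤ suc B
    |C|≤1+B = *-cancelʳ-≤ (length C) (suc B) 6 (subst (length C * 6 ≤_) total-load load-bound)
    |C|≢1+B : length C ≢ suc B
    |C|≢1+B |C|≡1+B = contradiction (begin
      1                                ≡⟨ odd-charge ⟨
      weight charge (allDiffs {m}) % 2 ≡⟨ cong (_% 2) charge-tight ⟨
      weight charge (diffsOf C) % 2    ≡⟨ diffsOf-weight-% ooc (proj₂ ∘ weights) ⟩
      (length C * 0) % 2               ≡⟨ cong (_% 2) (*-zeroʳ (length C)) ⟩
      0                                ∎) λ ()
      where
      open ≡-Reasoning
      load-tight : weight load (diffsOf C) ≡ weight load (allDiffs {m})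
      load-tight = trans (diffsOf-weight ooc (proj₁ ∘ weights)) (trans (cong (_* 6) |C|≡1+B) (sym total-load))
      charge-tight : weight charge (diffsOf C) ≡ weight charge (allDiffs {m})
      charge-tight = weight-tight load charge 3 (diffsOf-unique ooc) (diffsOf-⊆ ooc) charge≤3*load load-tight

x+2e≡54-cases : ∀ {x e} → x + 2 * e ≡ 54 → x ≤ 48 → e ≤ 4 → (e ≡ 3 × x ≡ 48) ⊎ (e ≡ 4 × x ≡ 46)
x+2e≡54-cases {x} {0} eq x≤48 _ = ⊥-elim (≤⇒≤ᵇ (subst (_≤ 48) (+-cancelʳ-≡ 0 x 54 eq) x≤48))
x+2e≡54-cases {x} {1} eq x≤48 _ = ⊥-elim (≤⇒≤ᵇ (subst (_≤ 48) (+-cancelʳ-≡ 2 x 52 eq) x≤48))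
x+2e≡54-cases {x} {2} eq x≤48 _ = ⊥-elim (≤⇒≤ᵇ (subst (_≤ 48) (+-cancelʳ-≡ 4 x 50 eq) x≤48))
x+2e≡54-cases {x} {3} eq _    _ = inj₁ (refl , +-cancelʳ-≡ 6 x 48 eq)
x+2e≡54-cases {x} {4} eq _    _ = inj₂ (refl , +-cancelʳ-≡ 8 x 46 eq)
x+2e≡54-cases {e = suc (suc (suc (suc (suc _))))} _ _ (s≤s (s≤s (s≤s (s≤s ()))))

≡2-mod-4⇒≤14 : ∀ {w} → w ≤ 16 → w % 4 ≡ 2 → w ≤ 14
≡2-mod-4⇒≤14 {w} w≤16 w%4≡2 with w ≤? 14
... | yes w≤14 = w≤14
... | no  w≰14 with m≤n⇒m<n∨m≡n w≤16
...   | inj₂ refl = contradiction w%4≡2 λ ()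
...   | inj₁ w<16 with ≤-antisym (≤-pred w<16) (≰⇒> w≰14)
...     | refl = contradiction w%4≡2 λ ()

-- Nine codewords have load 54 out of 48 + 2 · 4. Either every mixed difference is used, and then the
-- charge is odd; or every row carries a pure pair, and then each matching class of 16 mixed differences
-- is used a number of times ≡ 2 (mod 4), so at most 42 mixed differences are used instead of 46.
module _ {C : List (List (Point 4 4))} (ooc : IsOOC 4 4 3 C)
         (weights : ∀ {A : List (Point 4 4)} → Admissible 3 A → CodewordWeights A × ClassWeights A)
         (nine : length C ≡ 9) where

  private
    L : List (Diff 4 4)
    L = diffsOf C

  mixed+2*pure₁≡54 : weight mixed L + 2 * weight pure₁ L ≡ 54
  mixed+2*pure₁≡54 = begin
    weight mixed L + 2 * weight pure₁ L ≡⟨ weight-+-*ˡ mixed 2 pure₁ L ⟨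
    weight load L                       ≡⟨ diffsOf-weight ooc (proj₁ ∘ proj₁ ∘ weights) ⟩
    length C * 6                        ≡⟨ cong (_* 6) nine ⟩
    54                                  ∎
    where open ≡-Reasoning

  all-mixed-covered⇒⊥ : weight pure₁ L ≡ 3 → weight mixed L ≡ 48 → ⊥
  all-mixed-covered⇒⊥ pure₁≡3 mixed≡48 = contradiction (begin
    1                                          ≡⟨⟩
    (weight ascent (allDiffs {4} {4}) + 3) % 2 ≡⟨ cong (_% 2) (cong₂ _+_ ascent-tight pure₁≡3) ⟨
    (weight ascent L + weight pure₁ L) % 2     ≡⟨ cong (_% 2) (weight-charge L) ⟨
    weight charge L % 2                        ≡⟨ diffsOf-weight-% ooc (proj₂ ∘ proj₁ ∘ weights) ⟩
    (length C * 0) % 2                         ≡⟨ cong (_% 2) (*-zeroʳ (length C)) ⟩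
    0                                          ∎) λ ()
    where
    open ≡-Reasoning
    ascent-tight : weight ascent L ≡ weight ascent (allDiffs {4} {4})
    ascent-tight = weight-tight mixed ascent 3 (diffsOf-unique ooc) (diffsOf-⊆ ooc) ascent≤pred[n]*mixed mixed≡48

  matched≤14 : weight pure₁ L ≡ 4 → ∀ {c} → c ∈ classes → weight (matched c) allDiffs ≡ 16 →
               weight (matched c) L ≤ 14
  matched≤14 pure₁≡4 {c} c∈classes total =
    ≡2-mod-4⇒≤14 (subst (weight (matched c) L ≤_) total (diffsOf-weight≤ ooc (matched c))) (begin
      weight (matched c) L % 4                        ≡⟨ [m+kn]%n≡m%n (weight (matched c) L) 2 4 ⟨
      (weight (matched c) L + 2 * 4) % 4              ≡⟨ cong (λ e → (weight (matched c) L + 2 * e) % 4) pure₁≡4 ⟨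
      (weight (matched c) L + 2 * weight pure₁ L) % 4 ≡⟨ cong (_% 4) (weight-+-*ˡ (matched c) 2 pure₁ L) ⟨
      weight (classLoad c) L % 4                      ≡⟨ diffsOf-weight-% ooc class-weight ⟩
      (length C * 2) % 4                              ≡⟨ cong (λ k → (k * 2) % 4) nine ⟩
      2                                               ∎)
    where
    open ≡-Reasoning
    class-weight : ∀ {A} → Admissible 3 A → weight (classLoad c) (diffs A) % 4 ≡ 2
    class-weight adm = All.lookup (proj₂ (weights adm)) c∈classes

  some-mixed-uncovered⇒⊥ : weight pure₁ L ≡ 4 → weight mixed L ≡ 46 → ⊥
  some-mixed-uncovered⇒⊥ pure₁≡4 mixed≡46 = ≤⇒≤ᵇ (begin
    46                                                                    ≡⟨ mixed≡46 ⟨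
    weight mixed L                                                        ≡⟨ weight-mixed L ⟩
    weight (matched c₁) L + weight (matched c₂) L + weight (matched c₃) L ≤⟨ +-mono-≤ (+-mono-≤ ≤14₁ ≤14₂) ≤14₃ ⟩
    42                                                                    ∎)
    where
    open ≤-Reasoning
    ≤14₁ : weight (matched c₁) L ≤ 14
    ≤14₁ = matched≤14 pure₁≡4 (here refl) refl
    ≤14₂ : weight (matched c₂) L ≤ 14
    ≤14₂ = matched≤14 pure₁≡4 (there (here refl)) refl
    ≤14₃ : weight (matched c₃) L ≤ 14
    ≤14₃ = matched≤14 pure₁≡4 (there (there (here refl))) refl

  no-ninth-codeword : ⊥
  no-ninth-codeword with x+2e≡54-cases mixed+2*pure₁≡54 (diffsOf-weight≤ ooc mixed) (diffsOf-weight≤ ooc pure₁)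
  ... | inj₁ (pure₁≡3 , mixed≡48) = all-mixed-covered⇒⊥ pure₁≡3 mixed≡48
  ... | inj₂ (pure₁≡4 , mixed≡46) = some-mixed-uncovered⇒⊥ pure₁≡4 mixed≡46

C₂ : List (List (Point 2 4))
C₂ = ((0F , 2F) ∷ (0F , 3F) ∷ (1F , 2F) ∷ [])
   ∷ ((0F , 3F) ∷ (1F , 0F) ∷ (1F , 1F) ∷ [])
   ∷ []

C₃ : List (List (Point 3 4))
C₃ = ((0F , 2F) ∷ (0F , 3F) ∷ (1F , 2F) ∷ [])
   ∷ ((0F , 3F) ∷ (1F , 0F) ∷ (2F , 3F) ∷ [])
   ∷ ((0F , 3F) ∷ (1F , 1F) ∷ (2F , 1F) ∷ [])
   ∷ ((1F , 2F) ∷ (1F , 3F) ∷ (2F , 0F) ∷ [])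
   ∷ []

C₄ : List (List (Point 4 4))
C₄ = ((0F , 2F) ∷ (0F , 3F) ∷ (1F , 2F) ∷ [])
   ∷ ((0F , 3F) ∷ (1F , 0F) ∷ (1F , 1F) ∷ [])
   ∷ ((0F , 3F) ∷ (2F , 0F) ∷ (2F , 3F) ∷ [])
   ∷ ((0F , 3F) ∷ (2F , 1F) ∷ (3F , 3F) ∷ [])
   ∷ ((0F , 3F) ∷ (2F , 2F) ∷ (3F , 1F) ∷ [])
   ∷ ((1F , 3F) ∷ (2F , 3F) ∷ (3F , 3F) ∷ [])
   ∷ ((1F , 3F) ∷ (2F , 1F) ∷ (3F , 2F) ∷ [])
   ∷ ((1F , 3F) ∷ (3F , 0F) ∷ (3F , 1F) ∷ [])
   ∷ []

C₅ : List (List (Point 5 4))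
C₅ = ((1F , 3F) ∷ (3F , 2F) ∷ (4F , 3F) ∷ [])
   ∷ ((0F , 3F) ∷ (1F , 0F) ∷ (1F , 3F) ∷ [])
   ∷ ((0F , 3F) ∷ (2F , 2F) ∷ (4F , 2F) ∷ [])
   ∷ ((0F , 3F) ∷ (3F , 3F) ∷ (4F , 1F) ∷ [])
   ∷ ((3F , 3F) ∷ (4F , 2F) ∷ (4F , 3F) ∷ [])
   ∷ ((1F , 3F) ∷ (2F , 1F) ∷ (3F , 0F) ∷ [])
   ∷ ((0F , 3F) ∷ (2F , 1F) ∷ (3F , 2F) ∷ [])
   ∷ ((0F , 3F) ∷ (1F , 2F) ∷ (4F , 3F) ∷ [])
   ∷ ((1F , 3F) ∷ (2F , 3F) ∷ (3F , 1F) ∷ [])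
   ∷ ((0F , 3F) ∷ (3F , 0F) ∷ (3F , 1F) ∷ [])
   ∷ ((2F , 2F) ∷ (2F , 3F) ∷ (4F , 0F) ∷ [])
   ∷ ((0F , 3F) ∷ (1F , 1F) ∷ (4F , 0F) ∷ [])
   ∷ ((0F , 2F) ∷ (0F , 3F) ∷ (2F , 3F) ∷ [])
   ∷ ((1F , 3F) ∷ (2F , 2F) ∷ (4F , 1F) ∷ [])
   ∷ []

bound₂ : ∀ D → IsOOC 2 4 3 D → length D ≤ 2
bound₂ D ooc = *-cancelʳ-≤ (length D) 2 6 (load-bound ooc (admissible-by-enumeration 3 codewordWeights?))

bound₃ : ∀ D → IsOOC 3 4 3 D → length D ≤ 4
bound₃ D ooc = parity-bound ooc (admissible-by-enumeration 3 codewordWeights?) 4 refl refl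

bound₄ : ∀ D → IsOOC 4 4 3 D → length D ≤ 8
bound₄ D ooc = ≤-pred (≤∧≢⇒< |D|≤9 (no-ninth-codeword ooc weights))
  where
  weights : ∀ {A} → Admissible 3 A → CodewordWeights A × ClassWeights A
  weights = admissible-by-enumeration 3 (λ A → codewordWeights? A ×-dec classWeights? A)
  |D|≤9 : length D ≤ 9
  |D|≤9 = ≤-pred (*-cancelʳ-< 6 (length D) 10 (s≤s (≤-trans (load-bound ooc (proj₁ ∘ weights)) (m≤m+n 56 3))))

bound₅ : ∀ D → IsOOC 5 4 3 D → length D ≤ 14
bound₅ D ooc = parity-bound ooc (admissible-by-enumeration 3 codewordWeights?) 14 refl refl

lemma8p2 : (m : ℕ) → 2 ≤ m → m ≤ 5 →
    Σ (List (List (Point m 4))) (λ C → IsOptimalOOC m 4 3 C × length C ≡ J* m 4)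
lemma8p2 2 _ _ = C₂ , (from-yes (isOOC? 3 C₂) , bound₂) , refl
lemma8p2 3 _ _ = C₃ , (from-yes (isOOC? 3 C₃) , bound₃) , refl
lemma8p2 4 _ _ = C₄ , (from-yes (isOOC? 3 C₄) , bound₄) , refl
lemma8p2 5 _ _ = C₅ , (from-yes (isOOC? 3 C₅) , bound₅) , refl
lemma8p2 0 () _
lemma8p2 1 (s≤s ()) _
lemma8p2 (suc (suc (suc (suc (suc (suc _)))))) _ (s≤s (s≤s (s≤s (s≤s (s≤s ())))))
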